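{- Let $\Gamma,\Delta$ be finite sets of formulas in $For_1$ with $\Gamma\cup\Delta$ nonempty. If $\vDash_{\mathbf{H}_3}\Gamma\Rightarrow\Delta$ but $var(\Gamma)\not\subseteq var(\Delta)$, then there exists a proper subset $\Gamma'\subset\Gamma$ with $var(\Gamma')\subseteq var(\Delta)$ such that $\vDash_{\mathbf{H}_3}\Gamma'\Rightarrow\Delta$.
   Context: Fix a denumerable set $prop$ of propositional variables. $For_1$ is the set of formulas built from $prop$ with unary $\lnot$ and binary $\vee$. $var(\alpha)$ is the set of propositional variables in $\alpha$; $var(\Gamma)=\bigcup_{\gamma\in\Gamma}var(\gamma)$. Halldén's logic $\mathbf{H}_3$: truth values $\{1,\tfrac12,0\}$, designated set $\{1,\tfrac12\}$; valuations extend maps $prop\to\{1,\tfrac12,0\}$ by $\lnot1=0,\lnot\tfrac12=\tfrac12,\lnot0=1$, and $x\vee y=\tfrac12$ if $x=\tfrac12$ or $y=\tfrac12$, otherwise classical disjunction. $\vDash_{\mathbf{H}_3}\Gamma\Rightarrow\Delta$ means: for every valuation $v$, if $v(\gamma)\in\{1,\tfrac12\}$ for all $\gamma\in\Gamma$ then $v(\delta)\in\{1,\tfrac12\}$ for some $\delta\in\Delta$. -}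

module Defs where

open import Data.Nat using (ℕ)
open import Data.List using (List; _++_)
open import Data.List.Membership.Propositional using (_∈_)
open import Data.List.Relation.Unary.Any using (Any)
open import Data.Product using (Σ; _×_; ∃)
open import Relation.Nullary using (¬_)

Prop : Set
Prop = ℕ

data Form : Set where
  var  : Prop → Form
  neg  : Form → Form
  _∨′_ : Form → Form → Form

data OccursIn (x : Prop) : Form → Set where
  here  : OccursIn x (var x)
  inNeg : ∀ {a} → OccursIn x a → OccursIn x (neg a)
  inL   : ∀ {a b} → OccursIn x a → OccursIn x (a ∨′ b)
  inR   : ∀ {a b} → OccursIn x b → OccursIn x (a ∨′ b)

-- Finite sets of formulas are represented by lists (read as sets).
-- x ∈ var(Γ) = ⋃_{γ∈Γ} var(γ)
OccursInSet : Prop → List Form → Set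
OccursInSet x Γ = Any (OccursIn x) Γ

VarSub : List Form → List Form → Set
VarSub Γ Δ = ∀ x → OccursInSet x Γ → OccursInSet x Δ

ProperSubset : List Form → List Form → Set
ProperSubset Γ' Γ = (∀ γ → γ ∈ Γ' → γ ∈ Γ) × ∃ (λ γ → γ ∈ Γ × ¬ (γ ∈ Γ'))

data TV : Set where
  one half zero : TV

notH : TV → TV
notH one  = zero
notH half = half
notH zero = one

orH : TV → TV → TV
orH half _    = half
orH one  half = half
orH zero half = half
orH one  one  = one
orH one  zero = one
orH zero one  = one
orH zero zero = zero

eval : (Prop → TV) → Form → TV
eval v (var p)  = v p
eval v (neg a)  = notH (eval v a)
eval v (a ∨′ b) = orH (eval v a) (eval v b)

data Designated : TV → Set where
  d-one  : Designated one
  d-half : Designated half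

ValidH3 : List Form → List Form → Set
ValidH3 Γ Δ = (v : Prop → TV) →
  (∀ γ → γ ∈ Γ → Designated (eval v γ)) →
  Σ Form (λ δ → δ ∈ Δ × Designated (eval v δ))

module Submission where

-- Let Γ' be the members of Γ all of whose variables occur in Δ.  Then
-- var(Γ') ⊆ var(Δ), and Γ' is a proper subset of Γ because var(Γ) ⊈ var(Δ).  Given a valuation v designating Γ', let w
-- agree with v on var(Δ) and send every other variable to ½.  Two facts
-- about H₃ do the work:
--   * coincidence: the value of a formula depends only on its variables;
--   * infection:  ½ is absorbing for ¬ and ∨, so any formula containing a
--     variable valued ½ is itself valued ½, hence designated.
-- So w designates all of Γ: members of Γ' by coincidence with v, the other
-- members by infection.  Validity of Γ ⇒ Δ yields a designated δ ∈ Δ under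
-- w, and by coincidence δ is designated under v as well.

open import Defs
open import Data.Nat using (_≟_)
open import Data.List using (List; _++_; filter)
open import Data.List.Membership.Propositional using (_∈_; find; lose)
open import Data.List.Membership.Propositional.Properties using (∈-filter⁺; ∈-filter⁻)
open import Data.List.Relation.Unary.Any using (any?)
open import Data.List.Relation.Unary.All using (All) renaming (lookup to All-lookup)
open import Data.List.Relation.Unary.All.Properties using (¬All⇒Any¬)
open import Data.Product using (Σ; _×_; ∃; _,_; proj₁; proj₂)
open import Data.Sum using (_⊎_; inj₁; inj₂)
open import Data.Empty using (⊥-elim)
open import Relation.Nullary using (¬_; Dec; yes; no)
open import Relation.Binary.PropositionalEquality using (_≡_; refl; cong; cong₂; sym; subst)

occurs? : (x : Prop) (a : Form) → Dec (OccursIn x a)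
occurs? x (var p) with x ≟ p
... | yes refl = yes here
... | no x≢p   = no λ { here → x≢p refl }
occurs? x (neg a) with occurs? x a
... | yes o = yes (inNeg o)
... | no ¬o = no λ { (inNeg o) → ¬o o }
occurs? x (a ∨′ b) with occurs? x a | occurs? x b
... | yes o  | _     = yes (inL o)
... | no _   | yes o = yes (inR o)
... | no ¬oa | no ¬ob = no λ { (inL o) → ¬oa o ; (inR o) → ¬ob o }

occursInSet? : (x : Prop) (Δ : List Form) → Dec (OccursInSet x Δ)
occursInSet? x Δ = any? (occurs? x) Δ

VarsIn : List Form → Form → Set
VarsIn Δ a = ∀ x → OccursIn x a → OccursInSet x Δ

Escapes : List Form → Form → Set
Escapes Δ a = Σ Prop (λ x → OccursIn x a × ¬ OccursInSet x Δ)

-- Constructive dichotomy: either var(a) ⊆ var(Δ), or we can exhibit an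
-- escaping variable (needed to trigger infection below).
varsIn-or-escapes : (Δ : List Form) (a : Form) → VarsIn Δ a ⊎ Escapes Δ a
varsIn-or-escapes Δ (var p) with occursInSet? p Δ
... | yes o = inj₁ λ { _ here → o }
... | no ¬o = inj₂ (p , here , ¬o)
varsIn-or-escapes Δ (neg a) with varsIn-or-escapes Δ a
... | inj₁ g           = inj₁ λ { x (inNeg o) → g x o }
... | inj₂ (x , o , ¬o) = inj₂ (x , inNeg o , ¬o)
varsIn-or-escapes Δ (a ∨′ b) with varsIn-or-escapes Δ a | varsIn-or-escapes Δ b
... | inj₂ (x , o , ¬o) | _                 = inj₂ (x , inL o , ¬o)
... | inj₁ _            | inj₂ (x , o , ¬o) = inj₂ (x , inR o , ¬o)
... | inj₁ ga           | inj₁ gb           = inj₁ λ { x (inL o) → ga x o ; x (inR o) → gb x o }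

varsIn? : (Δ : List Form) (a : Form) → Dec (VarsIn Δ a)
varsIn? Δ a with varsIn-or-escapes Δ a
... | inj₁ g           = yes g
... | inj₂ (x , o , ¬o) = no λ g → ¬o (g x o)

varSub-from-members : (Γ Δ : List Form) → (∀ γ → γ ∈ Γ → VarsIn Δ γ) → VarSub Γ Δ
varSub-from-members Γ Δ members x x∈Γ with find x∈Γ
... | γ , γ∈Γ , o = members γ γ∈Γ x o

escaping-member : (Γ Δ : List Form) → ¬ VarSub Γ Δ → ∃ (λ γ → γ ∈ Γ × ¬ VarsIn Δ γ)
escaping-member Γ Δ ¬sub with find (¬All⇒Any¬ (varsIn? Δ) Γ ¬all)
  where
  ¬all : ¬ All (VarsIn Δ) Γ
  ¬all all = ¬sub (varSub-from-members Γ Δ (λ γ γ∈Γ → All-lookup all γ∈Γ))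
... | γ , γ∈Γ , ¬g = γ , γ∈Γ , ¬g

eval-coincidence : (v w : Prop → TV) (a : Form) →
  (∀ x → OccursIn x a → v x ≡ w x) → eval v a ≡ eval w a
eval-coincidence v w (var p)  agree = agree p here
eval-coincidence v w (neg a)  agree =
  cong notH (eval-coincidence v w a λ x o → agree x (inNeg o))
eval-coincidence v w (a ∨′ b) agree =
  cong₂ orH (eval-coincidence v w a λ x o → agree x (inL o))
            (eval-coincidence v w b λ x o → agree x (inR o))

orH-half-right : ∀ t → orH t half ≡ half
orH-half-right one  = refl
orH-half-right half = refl
orH-half-right zero = refl

half-infectious : (v : Prop → TV) (x : Prop) (a : Form) →
  OccursIn x a → v x ≡ half → eval v a ≡ half
half-infectious v x (var .x) here      vx = vx
half-infectious v x (neg a)  (inNeg o) vx = cong notH (half-infectious v x a o vx)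
half-infectious v x (a ∨′ b) (inL o)   vx = cong (λ t → orH t (eval v b)) (half-infectious v x a o vx)
half-infectious v x (a ∨′ b) (inR o)   vx rewrite half-infectious v x b o vx = orH-half-right (eval v a)

halfOutside : List Form → (Prop → TV) → Prop → TV
halfOutside Δ v x with occursInSet? x Δ
... | yes _ = v x
... | no _  = half

halfOutside-inside : ∀ Δ v x → OccursInSet x Δ → halfOutside Δ v x ≡ v x
halfOutside-inside Δ v x o with occursInSet? x Δ
... | yes _ = refl
... | no ¬o = ⊥-elim (¬o o)

halfOutside-outside : ∀ Δ v x → ¬ OccursInSet x Δ → halfOutside Δ v x ≡ half
halfOutside-outside Δ v x ¬o with occursInSet? x Δ
... | yes o = ⊥-elim (¬o o)
... | no _  = refl

halfOutside-coincides : ∀ Δ v a → VarsIn Δ a → eval (halfOutside Δ v) a ≡ eval v a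
halfOutside-coincides Δ v a g =
  eval-coincidence (halfOutside Δ v) v a λ x o → halfOutside-inside Δ v x (g x o)

drop-escaping-premises : (Γ Δ : List Form) →
  ValidH3 Γ Δ → ValidH3 (filter (varsIn? Δ) Γ) Δ
drop-escaping-premises Γ Δ valid v designatesΓ' with valid w designatesΓ
  where
  w : Prop → TV
  w = halfOutside Δ v
  designatesΓ : ∀ γ → γ ∈ Γ → Designated (eval w γ)
  designatesΓ γ γ∈Γ with varsIn-or-escapes Δ γ
  ... | inj₁ g = subst Designated (sym (halfOutside-coincides Δ v γ g))
                   (designatesΓ' γ (∈-filter⁺ (varsIn? Δ) γ∈Γ g))
  ... | inj₂ (x , o , ¬o) = subst Designated
                   (sym (half-infectious w x γ o (halfOutside-outside Δ v x ¬o))) d-half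
... | δ , δ∈Δ , d = δ , δ∈Δ ,
  subst Designated (halfOutside-coincides Δ v δ (λ _ o → lose δ∈Δ o)) d

mainTheorem19 : (Γ Δ : List Form) →
    ∃ (λ φ → φ ∈ Γ ++ Δ) →
    ValidH3 Γ Δ →
    ¬ VarSub Γ Δ →
    Σ (List Form) (λ Γ' → ProperSubset Γ' Γ × VarSub Γ' Δ × ValidH3 Γ' Δ)
mainTheorem19 Γ Δ _ valid ¬sub =
  Γ' , (Γ'⊆Γ , proper) , varSub-from-members Γ' Δ Γ'-varsIn , drop-escaping-premises Γ Δ valid
  where
  Γ' : List Form
  Γ' = filter (varsIn? Δ) Γ
  Γ'⊆Γ : ∀ γ → γ ∈ Γ' → γ ∈ Γ
  Γ'⊆Γ γ γ∈Γ' = proj₁ (∈-filter⁻ (varsIn? Δ) {xs = Γ} γ∈Γ')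
  Γ'-varsIn : ∀ γ → γ ∈ Γ' → VarsIn Δ γ
  Γ'-varsIn γ γ∈Γ' = proj₂ (∈-filter⁻ (varsIn? Δ) {xs = Γ} γ∈Γ')
  proper : ∃ (λ γ → γ ∈ Γ × ¬ (γ ∈ Γ'))
  proper with escaping-member Γ Δ ¬sub
  ... | γ , γ∈Γ , ¬g = γ , γ∈Γ , λ γ∈Γ' → ¬g (Γ'-varsIn γ γ∈Γ')
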